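{- For a positive integer $k$, let $a_k$ denote the number of nonempty $\otimes$-irreducible partition diagrams in $A_k$. Then $a_1 = 2$ and, for every $k \geq 1$, $$a_k = B_{2k} - \sum_{\substack{\alpha \vDash k \\ \alpha \neq (k)}} a_{\alpha_1} a_{\alpha_2} \cdots a_{\alpha_{\ell(\alpha)}},$$ where the sum is over all integer compositions $\alpha=(\alpha_1,\dots,\alpha_{\ell(\alpha)})$ of $k$ other than $(k)$, and $B_m$ denotes the $m$-th Bell number (the number of set partitions of an $m$-element set).
   Context: For $k \geq 0$, a partition diagram of order $k$ is a set partition of $\{1,\ldots,k,1',\ldots,k'\}$; $A_k$ denotes the set of all such diagrams (so $|A_k| = B_{2k}$), and $A_0=\{\varnothing\}$. For $\pi \in A_k$ and $\rho \in A_l$, $\pi \otimes \rho \in A_{k+l}$ is the set partition whose blocks are the blocks of $\pi$ together with the blocks of $\rho$ with every $i$ replaced by $i+k$ and every $i'$ by $(i+k)'$. A diagram is $\otimes$-irreducible if it cannot be written as $\rho^{(1)} \otimes \rho^{(2)}$ with $\rho^{(1)},\rho^{(2)}$ nonempty (of positive order). -}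

module Defs where

open import Data.Nat using (ℕ; zero; suc; _+_; _*_; _∸_; _≤_)
open import Data.Nat.Properties using () renaming (_≟_ to _≟ℕ_)
open import Data.Fin using (Fin; splitAt)
open import Data.Sum using (_⊎_; inj₁; inj₂)
open import Data.Bool using (Bool; true; false)
open import Data.Product using (Σ; _×_; _,_; ∃)
open import Data.List using (List; []; _∷_; [_]; map; concatMap; upTo; filter)
open import Data.Nat.ListAction using (sum; product)
import Data.List.Properties as LP
open import Relation.Nullary using (¬_; ¬?)
open import Relation.Binary.PropositionalEquality using (_≡_; subst)

-- The ground set {1,…,k,1',…,k'} : inj₁ i stands for i+1, inj₂ i for (i+1)'.
Point : ℕ → Set
Point k = Fin k ⊎ Fin k

-- A (Bool-valued) binary relation on the ground set; a set partition is
-- encoded by its "lie in the same block" relation.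
Rel : ℕ → Set
Rel k = Point k → Point k → Bool

IsSetPartition : ∀ {k} → Rel k → Set
IsSetPartition {k} R =
  (∀ x → R x x ≡ true) ×
  (∀ x y → R x y ≡ true → R y x ≡ true) ×
  (∀ x y z → R x y ≡ true → R y z ≡ true → R x z ≡ true)

_≈_ : ∀ {k} → Rel k → Rel k → Set
π ≈ ρ = ∀ x y → π x y ≡ ρ x y

splitPt : ∀ k {l} → Point (k + l) → Point k ⊎ Point l
splitPt k (inj₁ i) with splitAt k i
... | inj₁ j = inj₁ (inj₁ j)
... | inj₂ j = inj₂ (inj₁ j)
splitPt k (inj₂ i) with splitAt k i
... | inj₁ j = inj₁ (inj₂ j)
... | inj₂ j = inj₂ (inj₂ j)

_⊗_ : ∀ {k l} → Rel k → Rel l → Rel (k + l)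
_⊗_ {k} π ρ x y with splitPt k x | splitPt k y
... | inj₁ a | inj₁ b = π a b
... | inj₂ a | inj₂ b = ρ a b
... | inj₁ _ | inj₂ _ = false
... | inj₂ _ | inj₁ _ = false

Reducible : ∀ {k} → Rel k → Set
Reducible {k} π =
  Σ ℕ λ k₁ → Σ ℕ λ k₂ → (1 ≤ k₁) × (1 ≤ k₂) ×
  Σ (k₁ + k₂ ≡ k) λ e → Σ (Rel k₁) λ ρ₁ → Σ (Rel k₂) λ ρ₂ →
  IsSetPartition ρ₁ × IsSetPartition ρ₂ × (π ≈ subst Rel e (ρ₁ ⊗ ρ₂))

Irreducible : ∀ {k} → Rel k → Set
Irreducible π = ¬ Reducible π

IrredDiagram : (k : ℕ) → Rel k → Set
IrredDiagram k π = (1 ≤ k) × IsSetPartition π × Irreducible π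

-- Counting: "the number of elements of A_k (up to ≈) satisfying P is n"
-- means there is a ≈-injective family Fin n → Rel k of elements satisfying
-- P such that every element satisfying P is ≈ to a member of the family.

HasCount : (k : ℕ) → (Rel k → Set) → ℕ → Set
HasCount k P n =
  Σ (Fin n → Rel k) λ f →
    (∀ i → P (f i)) ×
    (∀ i j → f i ≈ f j → i ≡ j) ×
    (∀ π → P π → Σ (Fin n) λ i → π ≈ f i)

IrredCount : ℕ → ℕ → Set
IrredCount k n = HasCount k (IrredDiagram k) n

stirling₂ : ℕ → ℕ → ℕ
stirling₂ zero    zero    = 1
stirling₂ zero    (suc _) = 0
stirling₂ (suc n) zero    = 0
stirling₂ (suc n) (suc j) = suc j * stirling₂ n (suc j) + stirling₂ n j

bell : ℕ → ℕ
bell m = sum (map (stirling₂ m) (upTo (suc m)))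

-- Integer compositions of n: lists of positive integers summing to n,
-- generated by choosing the first part j ∈ {1,…,n}. The first argument is
-- fuel (≥ n suffices).

compositionsF : ℕ → ℕ → List (List ℕ)
compositionsF _        zero    = [ [] ]
compositionsF zero     (suc _) = []
compositionsF (suc f)  (suc n) =
  concatMap (λ j → map (suc j ∷_) (compositionsF f (n ∸ j))) (upTo (suc n))

compositions : ℕ → List (List ℕ)
compositions n = compositionsF n n

compSum : (ℕ → ℕ) → ℕ → ℕ
compSum a k =
  sum (map (λ α → product (map a α))
           (filter (λ α → ¬? (LP.≡-dec _≟ℕ_ α [ k ])) (compositions k)))

{-# OPTIONS --safe #-}

-- The set partitions of order k ≥ 1 are counted in two ways.
--
-- They are the equivalence relations on 2k points. Sorting these by their number of blocks, the
-- first point either joins one of the blocks of the remaining points or is a singleton, which is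
-- the Stirling recurrence; so there are B_{2k} of them.
--
-- Say π splits at column j if no block of π meets both the columns < j and the columns ≥ j; this
-- happens exactly when π = ρ ⊗ σ with ρ of order j. Cutting π at its least split j ≥ 1 is a
-- bijection between the set partitions of order k with least split j and the pairs (ρ, σ) with
-- ρ ∈ A_j irreducible and σ ∈ A_{k-j}. By induction on k there are Σ_{α ⊨ k} a_{α₁} ⋯ a_{α_ℓ}
-- set partitions of order k, and the composition (k) contributes a_k.
--
-- Sizes are taken up to pointwise equality of relations; two enumerations of one predicate
-- induce a bijection of their index sets, so sizes are unique. The numbers a_k exist because
-- irreducibility is decidable, which makes the irreducible diagrams a decidable subfamily of A_k.

module Submission where

open import Level using (Level; _⊔_; 0ℓ)
open import Data.Bool as Bool using (Bool; true; false)
open import Data.Bool.Properties using (⇔→≡; ¬-not)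
open import Data.Fin using (Fin; zero; suc; cast; toℕ; splitAt; _↑ˡ_; _↑ʳ_)
open import Data.Fin.Permutation using (↔⇒≡)
open import Data.Fin.Properties as Fin
  using ( +↔⊎; *↔×; any?; all?; cast-involutive; toℕ<n; toℕ-↑ˡ; toℕ-↑ʳ
        ; splitAt-↑ˡ; splitAt-↑ʳ; splitAt⁻¹-↑ˡ; splitAt⁻¹-↑ʳ )
open import Data.List
  using ( List; []; _∷_; [_]; _++_; _∷ʳ_; map; concatMap; length; lookup; filter
        ; allFin; applyUpTo; upTo )
open import Data.List.Membership.Propositional using (_∈_; _∉_; find)
open import Data.List.Membership.Propositional.Properties
  using (∈-lookup; ∈-filter⁺; ∈-filter⁻; ∈-allFin; ∈-map⁺; ∈-map⁻; ∈-concatMap⁻; ∈-upTo⁻)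
open import Data.List.Properties
  using ( ≡-dec; map-++; map-cong; map-∘; map-upTo; map-concatMap; concatMap-++; upTo-∷ʳ
        ; filter-++; filter-all; filter-none; ++-identityʳ; length-map; ∷-injectiveˡ )
open import Data.List.Relation.Unary.All as All using (All; []; _∷_)
open import Data.List.Relation.Unary.All.Properties using (¬Any⇒All¬)
open import Data.List.Relation.Unary.Any using (index; here; there)
open import Data.List.Relation.Unary.Any.Properties using (lookup-index)
open import Data.List.Relation.Unary.Unique.Propositional using (Unique; []; _∷_)
open import Data.List.Relation.Unary.Unique.Propositional.Properties using (filter⁺; allFin⁺; map⁺)
open import Data.Nat using (ℕ; zero; suc; _+_; _*_; _∸_; _≤_; _<_; z≤n; s≤s; _≤?_; _<?_)
open import Data.Nat.Induction using (<-rec)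
open import Data.Nat.ListAction using (sum; product)
open import Data.Nat.ListAction.Properties using (sum-++)
open import Data.Nat.Properties
  using ( _≟_; suc-injective; 0≢1+n; +-identityʳ; +-comm; *-identityʳ; *-zeroʳ; *-distribˡ-+
        ; ≤-refl; ≤-reflexive; ≤-trans; <-trans; <-irrefl; <⇒≤; ≤⇒≯; ≮⇒≥; <-cmp
        ; m≤m+n; m<m+n; m≤n⇒m≤1+n; m∸n≤m; n∸n≡0; m+[n∸m]≡n; m<n⇒0<n∸m; anyUpTo? )
open import Data.Product using (Σ; ∃-syntax; _×_; _,_; proj₁; proj₂)
open import Data.Sum as Sum using (_⊎_; inj₁; inj₂; [_,_]′)
open import Function using (_∘_; _on_; _↔_; mk↔ₛ′; Inverse; mk⇔)
open import Relation.Binary using (Setoid; tri<; tri≈; tri>)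
open import Relation.Binary.PropositionalEquality as ≡ using (_≡_; _≢_; cong)
open import Relation.Nullary using (¬_; Dec; contradiction; yes; no)
open import Relation.Nullary.Decidable using (toSum; map′; ¬?; _×-dec_; _→-dec_)
open import Relation.Unary using (Decidable)

open import Defs hiding (_≈_)

lookup-injective : ∀ {a} {A : Set a} {xs : List A} → Unique xs →
                   ∀ {i j} → lookup xs i ≡ lookup xs j → i ≡ j
lookup-injective (_ ∷ _)    {zero}  {zero}  _ = ≡.refl
lookup-injective (x∉xs ∷ _) {zero}  {suc j} e = contradiction e (All.lookup x∉xs (∈-lookup j))
lookup-injective (x∉xs ∷ _) {suc i} {zero}  e =
  contradiction (≡.sym e) (All.lookup x∉xs (∈-lookup i))
lookup-injective (_ ∷ xs!)  {suc i} {suc j} e = cong suc (lookup-injective xs! e)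

module Enumerations {a ℓ} (S : Setoid a ℓ) where

  open Setoid S renaming (Carrier to A)

  private variable
    i j p q : Level
    I : Set i
    J : Set j
    P : A → Set p
    Q : A → Set q

  Enumeration : Set i → (A → Set p) → Set (a ⊔ ℓ ⊔ i ⊔ p)
  Enumeration I P =
    Σ (I → A) λ f →
      (∀ i → P (f i)) ×
      (∀ i j → f i ≈ f j → i ≡ j) ×
      (∀ x → P x → Σ I λ i → x ≈ f i)

  HasSize : (A → Set p) → ℕ → Set (a ⊔ ℓ ⊔ p)
  HasSize P n = Enumeration (Fin n) P

  enumerations-↔ : Enumeration I P → Enumeration J P → I ↔ J
  enumerations-↔ {I = I} {J = J} (f , Pf , f-inj , f-onto) (g , Pg , g-inj , g-onto) =
    mk↔ₛ′ to from (λ j → g-inj _ _ (g-round-trip j)) (λ i → f-inj _ _ (f-round-trip i))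
    where
    to : I → J
    to i = proj₁ (g-onto (f i) (Pf i))
    from : J → I
    from j = proj₁ (f-onto (g j) (Pg j))
    g-round-trip : ∀ j → g (to (from j)) ≈ g j
    g-round-trip j = trans (sym (proj₂ (g-onto _ _))) (sym (proj₂ (f-onto _ _)))
    f-round-trip : ∀ i → f (from (to i)) ≈ f i
    f-round-trip i = trans (sym (proj₂ (f-onto _ _))) (sym (proj₂ (g-onto _ _)))

  size-unique : ∀ {m n} → HasSize P m → HasSize P n → m ≡ n
  size-unique e e′ = ↔⇒≡ (enumerations-↔ e e′)

  enumeration-reindex : J ↔ I → Enumeration I P → Enumeration J P
  enumeration-reindex J↔I (f , Pf , f-inj , f-onto) =
    f ∘ to , Pf ∘ to ,
    (λ j j′ e → ≡.trans (≡.sym (strictlyInverseʳ j))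
                        (≡.trans (cong from (f-inj _ _ e)) (strictlyInverseʳ j′))) ,
    λ x Px → let i , x≈fi = f-onto x Px in
             from i , trans x≈fi (reflexive (cong f (≡.sym (strictlyInverseˡ i))))
    where open Inverse J↔I

  enumeration-⇔ : (∀ {x} → P x → Q x) → (∀ {x} → Q x → P x) →
                  Enumeration I P → Enumeration I Q
  enumeration-⇔ P⇒Q Q⇒P (f , Pf , f-inj , f-onto) =
    f , P⇒Q ∘ Pf , f-inj , λ x → f-onto x ∘ Q⇒P

  size-zero : (∀ x → ¬ P x) → HasSize P 0
  size-zero ¬P = (λ ()) , (λ ()) , (λ ()) , λ x Px → contradiction Px (¬P x)

  enumeration-⊎ : Enumeration I P → Enumeration J Q → (∀ {x y} → P x → Q y → ¬ x ≈ y) →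
                  Enumeration (I ⊎ J) (λ x → P x ⊎ Q x)
  enumeration-⊎ {I = I} {P = P} {J = J} {Q = Q}
                (f , Pf , f-inj , f-onto) (g , Qg , g-inj , g-onto) disjoint = h , Ph , h-inj , h-onto
    where
    h : I ⊎ J → A
    h (inj₁ i) = f i
    h (inj₂ j) = g j
    Ph : ∀ k → P (h k) ⊎ Q (h k)
    Ph (inj₁ i) = inj₁ (Pf i)
    Ph (inj₂ j) = inj₂ (Qg j)
    h-inj : ∀ k k′ → h k ≈ h k′ → k ≡ k′
    h-inj (inj₁ i) (inj₁ i′) e = cong inj₁ (f-inj i i′ e)
    h-inj (inj₂ j) (inj₂ j′) e = cong inj₂ (g-inj j j′ e)
    h-inj (inj₁ i) (inj₂ j)  e = contradiction e (disjoint (Pf i) (Qg j))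
    h-inj (inj₂ j) (inj₁ i)  e = contradiction (sym e) (disjoint (Pf i) (Qg j))
    h-onto : ∀ x → P x ⊎ Q x → Σ (I ⊎ J) λ k → x ≈ h k
    h-onto x (inj₁ Px) = let i , x≈fi = f-onto x Px in inj₁ i , x≈fi
    h-onto x (inj₂ Qx) = let j , x≈gj = g-onto x Qx in inj₂ j , x≈gj

  size-+ : ∀ {m n} → HasSize P m → HasSize Q n → (∀ {x y} → P x → Q y → ¬ x ≈ y) →
           HasSize (λ x → P x ⊎ Q x) (m + n)
  size-+ eP eQ disjoint = enumeration-reindex +↔⊎ (enumeration-⊎ eP eQ disjoint)

  size-* : ∀ {m n} → Enumeration (Fin m × Fin n) P → HasSize P (m * n)
  size-* = enumeration-reindex *↔×

  size-⋃< : ∀ b {Q : ℕ → A → Set p} {c : ℕ → ℕ} →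
            (∀ j → j < b → HasSize (Q j) (c j)) →
            (∀ {j j′ x y} → Q j x → Q j′ y → x ≈ y → j ≡ j′) →
            HasSize (λ x → ∃[ j ] j < b × Q j x) (sum (applyUpTo c b))
  size-⋃< zero    sizes disjoint = size-zero λ { x (_ , () , _) }
  size-⋃< (suc b) {Q} sizes disjoint =
    enumeration-⇔ from-⊎ to-⊎
      (size-+ (sizes 0 (s≤s z≤n))
              (size-⋃< b (λ j j<b → sizes (suc j) (s≤s j<b))
                         λ Qx Qy x≈y → suc-injective (disjoint Qx Qy x≈y))
              λ { Q₀x (_ , _ , Qy) x≈y → 0≢1+n (disjoint Q₀x Qy x≈y) })
    where
    from-⊎ : ∀ {x} → Q 0 x ⊎ (∃[ j ] j < b × Q (suc j) x) → ∃[ j ] j < suc b × Q j x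
    from-⊎ (inj₁ Q₀x) = 0 , s≤s z≤n , Q₀x
    from-⊎ (inj₂ (j , j<b , Qx)) = suc j , s≤s j<b , Qx
    to-⊎ : ∀ {x} → ∃[ j ] j < suc b × Q j x → Q 0 x ⊎ (∃[ j ] j < b × Q (suc j) x)
    to-⊎ (zero , _ , Qx) = inj₁ Qx
    to-⊎ (suc j , s≤s j<b , Qx) = inj₂ (j , j<b , Qx)

  size-filter : ∀ {n} {D : A → Set q} → HasSize P n → Decidable D →
                (∀ {x y} → x ≈ y → D x → D y) → (∀ {x} → D x → P x) → ∃[ c ] HasSize D c
  size-filter {n = n} {D = D} (f , Pf , f-inj , f-onto) D? D-resp D⇒P =
    length L , f ∘ lookup L , D-lookup , lookup-inj , onto
    where
    L : List (Fin n)
    L = filter (D? ∘ f) (allFin n)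
    D-lookup : ∀ t → D (f (lookup L t))
    D-lookup t = proj₂ (∈-filter⁻ (D? ∘ f) {xs = allFin n} (∈-lookup t))
    lookup-inj : ∀ t t′ → f (lookup L t) ≈ f (lookup L t′) → t ≡ t′
    lookup-inj t t′ e = lookup-injective (filter⁺ (D? ∘ f) (allFin⁺ n)) (f-inj _ _ e)
    onto : ∀ x → D x → Σ (Fin (length L)) λ t → x ≈ f (lookup L t)
    onto x Dx with f-onto x (D⇒P Dx)
    ... | k , x≈fk = index k∈L , trans x≈fk (reflexive (cong f (lookup-index k∈L)))
      where
      k∈L : k ∈ L
      k∈L = ∈-filter⁺ (D? ∘ f) (∈-allFin k) (D-resp x≈fk Dx)

_≋_ : ∀ {X : Set} → (X → X → Bool) → (X → X → Bool) → Set
R ≋ S = ∀ x y → R x y ≡ S x y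

BoolRel-setoid : Set → Setoid 0ℓ 0ℓ
BoolRel-setoid X = record
  { Carrier       = X → X → Bool
  ; _≈_           = _≋_
  ; isEquivalence = record
    { refl  = λ _ _ → ≡.refl
    ; sym   = λ e x y → ≡.sym (e x y)
    ; trans = λ e e′ x y → ≡.trans (e x y) (e′ x y)
    }
  }

-- For X = Point k, HasSize unfolds to Defs.HasCount k, and IsEquivalenceᵇ below to IsSetPartition.
module BoolRelEnumerations {X : Set} = Enumerations (BoolRel-setoid X)
open BoolRelEnumerations

IsEquivalenceᵇ : ∀ {X : Set} → (X → X → Bool) → Set
IsEquivalenceᵇ R =
  (∀ x → R x x ≡ true) ×
  (∀ x y → R x y ≡ true → R y x ≡ true) ×
  (∀ x y z → R x y ≡ true → R y z ≡ true → R x z ≡ true)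

isEquivalenceᵇ-on : ∀ {X Y : Set} {R : Y → Y → Bool} (h : X → Y) →
                    IsEquivalenceᵇ R → IsEquivalenceᵇ (R on h)
isEquivalenceᵇ-on h (refl , sym , trans) =
  (λ x → refl (h x)) , (λ x y → sym (h x) (h y)) , λ x y z → trans (h x) (h y) (h z)

isEquivalenceᵇ-resp : ∀ {X : Set} {R S : X → X → Bool} → R ≋ S →
                      IsEquivalenceᵇ R → IsEquivalenceᵇ S
isEquivalenceᵇ-resp R≋S (refl , sym , trans) =
  (λ x → ≡.trans (≡.sym (R≋S x x)) (refl x)) ,
  (λ x y Sxy → ≡.trans (≡.sym (R≋S y x)) (sym x y (≡.trans (R≋S x y) Sxy))) ,
  λ x y z Sxy Syz → ≡.trans (≡.sym (R≋S x z))
                            (trans x y z (≡.trans (R≋S x y) Sxy) (≡.trans (R≋S y z) Syz))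

size-equivalences-↔ : ∀ {X Y : Set} → X ↔ Y → ∀ {n} →
                      HasSize {X} IsEquivalenceᵇ n → HasSize {Y} IsEquivalenceᵇ n
size-equivalences-↔ X↔Y (f , Ef , f-inj , f-onto) =
  (λ i → f i on from) , (λ i → isEquivalenceᵇ-on from (Ef i)) ,
  (λ i j e → f-inj i j λ x x′ →
     ≡.subst₂ (λ u v → f i u v ≡ f j u v)
              (strictlyInverseʳ x) (strictlyInverseʳ x′) (e (to x) (to x′))) ,
  λ R E → let i , R≋fi = f-onto (R on to) (isEquivalenceᵇ-on to E) in
          i , λ y y′ → ≡.subst₂ (λ u v → R u v ≡ f i (from y) (from y′))
                                (strictlyInverseˡ y) (strictlyInverseˡ y′) (R≋fi (from y) (from y′))
  where open Inverse X↔Y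

JoinsLater : ∀ {m} → (Fin (suc m) → Fin (suc m) → Bool) → Set
JoinsLater R = ∃[ b ] R zero (suc b) ≡ true

joinsLater? : ∀ {m} → Decidable (JoinsLater {m})
joinsLater? R = any? λ b → R zero (suc b) Bool.≟ true

-- 0 is the largest element of its block iff it is related to no later point.
blockMaxima : ∀ {m} → (Fin m → Fin m → Bool) → List (Fin m)
blockMaxima {zero}  R = []
blockMaxima {suc m} R with joinsLater? R
... | yes _ = map suc (blockMaxima (R on suc))
... | no  _ = zero ∷ map suc (blockMaxima (R on suc))

blockCount : ∀ {m} → (Fin m → Fin m → Bool) → ℕ
blockCount R = length (blockMaxima R)

blockMaxima-unique : ∀ {m} (R : Fin m → Fin m → Bool) → Unique (blockMaxima R)
blockMaxima-unique {zero}  R = []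
blockMaxima-unique {suc m} R with joinsLater? R
... | yes _ = map⁺ Fin.suc-injective (blockMaxima-unique (R on suc))
... | no  _ = ¬Any⇒All¬ _ zero∉ ∷ map⁺ Fin.suc-injective (blockMaxima-unique (R on suc))
  where
  zero∉ : ∀ {xs : List (Fin m)} → zero ∉ map suc xs
  zero∉ z∈ with ∈-map⁻ suc z∈
  ... | _ , _ , ()

blockMaxima-cong : ∀ {m} {R S : Fin m → Fin m → Bool} → R ≋ S → blockMaxima R ≡ blockMaxima S
blockMaxima-cong {zero}  R≋S = ≡.refl
blockMaxima-cong {suc m} {R} {S} R≋S with joinsLater? R | joinsLater? S
... | yes _ | yes _ = cong (map suc) (blockMaxima-cong λ a b → R≋S (suc a) (suc b))
... | no  _ | no  _ = cong (λ xs → zero ∷ map suc xs) (blockMaxima-cong λ a b → R≋S (suc a) (suc b))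
... | yes (b , Rb) | no ¬S = contradiction (b , ≡.trans (≡.sym (R≋S zero (suc b))) Rb) ¬S
... | no ¬R | yes (b , Sb) = contradiction (b , ≡.trans (R≋S zero (suc b)) Sb) ¬R

blockCount≤ : ∀ {m} (R : Fin m → Fin m → Bool) → blockCount R ≤ m
blockCount≤ {zero}  R = z≤n
blockCount≤ {suc m} R with joinsLater? R
... | yes _ = ≤-trans (≤-reflexive (length-map suc (blockMaxima (R on suc))))
                    (m≤n⇒m≤1+n (blockCount≤ (R on suc)))
... | no  _ = s≤s (≤-trans (≤-reflexive (length-map suc (blockMaxima (R on suc))))
                         (blockCount≤ (R on suc)))

blockMaxima-cover : ∀ {m} {R : Fin m → Fin m → Bool} → IsEquivalenceᵇ R →
                    ∀ x → ∃[ r ] r ∈ blockMaxima R × R x r ≡ true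
blockMaxima-cover {suc m} {R} E@(refl , _ , trans) x with joinsLater? R | x
... | no _         | zero  = zero , here ≡.refl , refl zero
... | yes (b , Rb) | zero  = let r , r∈ , Rbr = blockMaxima-cover (isEquivalenceᵇ-on suc E) b in
                             suc r , ∈-map⁺ suc r∈ , trans zero (suc b) (suc r) Rb Rbr
... | yes _        | suc a = let r , r∈ , Rar = blockMaxima-cover (isEquivalenceᵇ-on suc E) a in
                             suc r , ∈-map⁺ suc r∈ , Rar
... | no _         | suc a = let r , r∈ , Rar = blockMaxima-cover (isEquivalenceᵇ-on suc E) a in
                             suc r , there (∈-map⁺ suc r∈) , Rar

∈-blockMaxima⁻ : ∀ {m} {R : Fin (suc m) → Fin (suc m) → Bool} {r} → r ∈ blockMaxima R →
                 (r ≡ zero × ¬ JoinsLater R) ⊎ (∃[ s ] r ≡ suc s × s ∈ blockMaxima (R on suc))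
∈-blockMaxima⁻ {R = R} r∈ with joinsLater? R | r∈
... | yes _  | r∈′        = let s , s∈ , r≡ = ∈-map⁻ suc r∈′ in inj₂ (s , r≡ , s∈)
... | no ¬J | here r≡0   = inj₁ (r≡0 , ¬J)
... | no _  | there r∈′  = let s , s∈ , r≡ = ∈-map⁻ suc r∈′ in inj₂ (s , r≡ , s∈)

blockMaxima-related : ∀ {m} {R : Fin m → Fin m → Bool} → IsEquivalenceᵇ R →
                      ∀ {r r′} → r ∈ blockMaxima R → r′ ∈ blockMaxima R → R r r′ ≡ true → r ≡ r′
blockMaxima-related {suc m} E@(_ , sym , _) r∈ r′∈ Rrr′
  with ∈-blockMaxima⁻ r∈ | ∈-blockMaxima⁻ r′∈
... | inj₁ (≡.refl , _)       | inj₁ (≡.refl , _)         = ≡.refl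
... | inj₁ (≡.refl , ¬J)      | inj₂ (s′ , ≡.refl , _)    = contradiction (s′ , Rrr′) ¬J
... | inj₂ (s , ≡.refl , _)   | inj₁ (≡.refl , ¬J)        = contradiction (s , sym _ _ Rrr′) ¬J
... | inj₂ (_ , ≡.refl , s∈)  | inj₂ (_ , ≡.refl , s′∈)   =
  cong suc (blockMaxima-related (isEquivalenceᵇ-on suc E) s∈ s′∈ Rrr′)

extend : ∀ {m} → (Fin m → Bool) → (Fin m → Fin m → Bool) → Fin (suc m) → Fin (suc m) → Bool
extend c R zero    zero    = true
extend c R zero    (suc b) = c b
extend c R (suc a) zero    = c a
extend c R (suc a) (suc b) = R a b

extend-cong : ∀ {m} {c d : Fin m → Bool} {R S} → (∀ a → c a ≡ d a) → R ≋ S →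
              extend c R ≋ extend d S
extend-cong c≗d R≋S zero    zero    = ≡.refl
extend-cong c≗d R≋S zero    (suc b) = c≗d b
extend-cong c≗d R≋S (suc a) zero    = c≗d a
extend-cong c≗d R≋S (suc a) (suc b) = R≋S a b

isEquivalenceᵇ-extend : ∀ {m} {c : Fin m → Bool} {R} → IsEquivalenceᵇ R →
                        (∀ a b → c a ≡ true → R a b ≡ true → c b ≡ true) →
                        (∀ a b → c a ≡ true → c b ≡ true → R a b ≡ true) →
                        IsEquivalenceᵇ (extend c R)
isEquivalenceᵇ-extend {c = c} {R} (refl , sym , trans) c-closed c-related = refl′ , sym′ , trans′
  where
  refl′ : ∀ x → extend c R x x ≡ true
  refl′ zero    = ≡.refl
  refl′ (suc a) = refl a
  sym′ : ∀ x y → extend c R x y ≡ true → extend c R y x ≡ true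
  sym′ zero    zero    p = p
  sym′ zero    (suc b) p = p
  sym′ (suc a) zero    p = p
  sym′ (suc a) (suc b) p = sym a b p
  trans′ : ∀ x y z → extend c R x y ≡ true → extend c R y z ≡ true → extend c R x z ≡ true
  trans′ zero    zero    z       p q = q
  trans′ zero    (suc b) zero    p q = ≡.refl
  trans′ zero    (suc b) (suc d) p q = c-closed b d p q
  trans′ (suc a) zero    zero    p q = p
  trans′ (suc a) zero    (suc d) p q = c-related a d p q
  trans′ (suc a) (suc b) zero    p q = c-closed b a q (sym a b p)
  trans′ (suc a) (suc b) (suc d) p q = trans a b d p q

joinBlockOf : ∀ {m} → Fin m → (Fin m → Fin m → Bool) → Fin (suc m) → Fin (suc m) → Bool
joinBlockOf r R = extend (R r) R

newBlock : ∀ {m} → (Fin m → Fin m → Bool) → Fin (suc m) → Fin (suc m) → Bool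
newBlock = extend (λ _ → false)

isEquivalenceᵇ-joinBlockOf : ∀ {m} {R : Fin m → Fin m → Bool} r → IsEquivalenceᵇ R →
                             IsEquivalenceᵇ (joinBlockOf r R)
isEquivalenceᵇ-joinBlockOf r E@(_ , sym , trans) =
  isEquivalenceᵇ-extend E (λ a b → trans r a b) (λ a b Rra → trans a r b (sym r a Rra))

isEquivalenceᵇ-newBlock : ∀ {m} {R : Fin m → Fin m → Bool} → IsEquivalenceᵇ R →
                          IsEquivalenceᵇ (newBlock R)
isEquivalenceᵇ-newBlock E = isEquivalenceᵇ-extend E (λ _ _ ()) (λ _ _ ())

joinsLater-η : ∀ {m} {R : Fin (suc m) → Fin (suc m) → Bool} → IsEquivalenceᵇ R →
               ∀ r → R zero (suc r) ≡ true → R ≋ joinBlockOf r (R on suc)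
joinsLater-η E@(refl , sym , trans) r R0r zero    zero    = refl zero
joinsLater-η E@(refl , sym , trans) r R0r zero    (suc b) =
  ⇔→≡ (mk⇔ (λ R0b → trans _ _ _ (sym _ _ R0r) R0b) (λ Rrb → trans _ _ _ R0r Rrb))
joinsLater-η E@(refl , sym , trans) r R0r (suc a) zero    =
  ⇔→≡ (mk⇔ (λ Ra0 → trans _ _ _ (sym _ _ R0r) (sym _ _ Ra0))
           (λ Rra → trans _ _ _ (sym _ _ Rra) (sym _ _ R0r)))
joinsLater-η E@(refl , sym , trans) r R0r (suc a) (suc b) = ≡.refl

¬joinsLater-η : ∀ {m} {R : Fin (suc m) → Fin (suc m) → Bool} → IsEquivalenceᵇ R →
                ¬ JoinsLater R → R ≋ newBlock (R on suc)
¬joinsLater-η (refl , sym , _) ¬J zero    zero    = refl zero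
¬joinsLater-η (refl , sym , _) ¬J zero    (suc b) = ¬-not λ R0b → ¬J (b , R0b)
¬joinsLater-η (refl , sym , _) ¬J (suc a) zero    = ¬-not λ Ra0 → ¬J (a , sym _ _ Ra0)
¬joinsLater-η (refl , sym , _) ¬J (suc a) (suc b) = ≡.refl

blockCount-joinsLater : ∀ {m} {R : Fin (suc m) → Fin (suc m) → Bool} →
                        JoinsLater R → blockCount R ≡ blockCount (R on suc)
blockCount-joinsLater {R = R} J with joinsLater? R
... | yes _ = length-map suc (blockMaxima (R on suc))
... | no ¬J = contradiction J ¬J

blockCount-¬joinsLater : ∀ {m} {R : Fin (suc m) → Fin (suc m) → Bool} →
                         ¬ JoinsLater R → blockCount R ≡ suc (blockCount (R on suc))
blockCount-¬joinsLater {R = R} ¬J with joinsLater? R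
... | yes J = contradiction J ¬J
... | no _  = cong suc (length-map suc (blockMaxima (R on suc)))

HasBlocks : ∀ {m} → ℕ → (Fin m → Fin m → Bool) → Set
HasBlocks k R = IsEquivalenceᵇ R × blockCount R ≡ k

blockMaximum : ∀ {m k} (R : Fin m → Fin m → Bool) → blockCount R ≡ k → Fin k → Fin m
blockMaximum R e t = lookup (blockMaxima R) (cast (≡.sym e) t)

joinBlock : ∀ {m k} (R : Fin m → Fin m → Bool) → blockCount R ≡ k → Fin k →
            Fin (suc m) → Fin (suc m) → Bool
joinBlock R e t = joinBlockOf (blockMaximum R e t) R

hasBlocks-joinBlock : ∀ {m k} {R : Fin m → Fin m → Bool} ((E , e) : HasBlocks k R) →
                      ∀ t → HasBlocks k (joinBlock R e t) × JoinsLater (joinBlock R e t)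
hasBlocks-joinBlock {m} {R = R} (E@(refl , _ , _) , e) t =
  (isEquivalenceᵇ-joinBlockOf r E , ≡.trans (blockCount-joinsLater joins) e) , joins
  where
  r : Fin m
  r = blockMaximum R e t
  joins : JoinsLater (joinBlock R e t)
  joins = r , refl r

joinBlock-injective : ∀ {m k} {R : Fin m → Fin m → Bool} → IsEquivalenceᵇ R →
                      (e : blockCount R ≡ k) → ∀ {t t′} → joinBlock R e t ≋ joinBlock R e t′ → t ≡ t′
joinBlock-injective {R = R} E@(refl , _ , _) e {t} {t′} t≋t′ = begin
  t                           ≡⟨ cast-involutive e (≡.sym e) t ⟨
  cast e (cast (≡.sym e) t)   ≡⟨ cong (cast e) (lookup-injective (blockMaxima-unique R) maxima-equal) ⟩
  cast e (cast (≡.sym e) t′)  ≡⟨ cast-involutive e (≡.sym e) t′ ⟩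
  t′                          ∎
  where
  open ≡.≡-Reasoning
  maxima-related : R (blockMaximum R e t) (blockMaximum R e t′) ≡ true
  maxima-related = ≡.trans (t≋t′ zero (suc (blockMaximum R e t′))) (refl _)
  maxima-equal : blockMaximum R e t ≡ blockMaximum R e t′
  maxima-equal = blockMaxima-related E (∈-lookup _) (∈-lookup _) maxima-related

joinBlock-onto : ∀ {m k} {R : Fin (suc m) → Fin (suc m) → Bool} {S} →
                 IsEquivalenceᵇ R → JoinsLater R → (R on suc) ≋ S → (e : blockCount S ≡ k) →
                 Σ (Fin k) λ t → R ≋ joinBlock S e t
joinBlock-onto {k = k} {R} {S} E@(_ , _ , trans) (b , R0b) R≋S e
  with blockMaxima-cover (isEquivalenceᵇ-on suc E) b
... | r , r∈ , Rbr = t , λ x y → begin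
  R x y                         ≡⟨ joinsLater-η E r (trans _ _ _ R0b Rbr) x y ⟩
  joinBlockOf r (R on suc) x y  ≡⟨ extend-cong (R≋S r) R≋S x y ⟩
  joinBlockOf r S x y           ≡⟨ cong (λ r′ → joinBlockOf r′ S x y) r≡max ⟩
  joinBlock S e t x y           ∎
  where
  open ≡.≡-Reasoning
  r∈S : r ∈ blockMaxima S
  r∈S = ≡.subst (r ∈_) (blockMaxima-cong R≋S) r∈
  t : Fin k
  t = cast e (index r∈S)
  r≡max : r ≡ blockMaximum S e t
  r≡max = ≡.trans (lookup-index r∈S)
                  (cong (lookup (blockMaxima S)) (≡.sym (cast-involutive (≡.sym e) e (index r∈S))))

size-joinsLater : ∀ {m k n} → HasSize (HasBlocks {m} k) n →
                  HasSize (λ R → HasBlocks k R × JoinsLater R) (k * n)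
size-joinsLater {m} {k} {n} (f , Hf , f-inj , f-onto) = size-* (φ , Hφ , φ-inj , φ-onto)
  where
  φ : Fin k × Fin n → Fin (suc m) → Fin (suc m) → Bool
  φ (t , s) = joinBlock (f s) (proj₂ (Hf s)) t
  Hφ : ∀ i → HasBlocks k (φ i) × JoinsLater (φ i)
  Hφ (t , s) = hasBlocks-joinBlock (Hf s) t
  φ-inj : ∀ i i′ → φ i ≋ φ i′ → i ≡ i′
  φ-inj (t , s) (t′ , s′) φ≋ with f-inj s s′ (λ a b → φ≋ (suc a) (suc b))
  ... | ≡.refl = cong (_, s) (joinBlock-injective (proj₁ (Hf s)) (proj₂ (Hf s)) φ≋)
  φ-onto : ∀ R → HasBlocks k R × JoinsLater R → Σ (Fin k × Fin n) λ i → R ≋ φ i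
  φ-onto R ((E , e) , J) =
    let s , R≋fs = f-onto (R on suc)
                          (isEquivalenceᵇ-on suc E , ≡.trans (≡.sym (blockCount-joinsLater J)) e)
        t , R≋φ = joinBlock-onto E J R≋fs (proj₂ (Hf s))
    in (t , s) , R≋φ

size-¬joinsLater : ∀ {m k n} → HasSize (HasBlocks {m} k) n →
                   HasSize (λ R → HasBlocks (suc k) R × ¬ JoinsLater R) n
size-¬joinsLater {m} {k} {n} (f , Hf , f-inj , f-onto) = newBlock ∘ f , Hφ , φ-inj , φ-onto
  where
  ¬joins : ∀ {R : Fin m → Fin m → Bool} → ¬ JoinsLater (newBlock R)
  ¬joins (_ , ())
  Hφ : ∀ s → HasBlocks (suc k) (newBlock (f s)) × ¬ JoinsLater (newBlock (f s))
  Hφ s = (isEquivalenceᵇ-newBlock (proj₁ (Hf s)) ,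
          ≡.trans (blockCount-¬joinsLater (¬joins {f s})) (cong suc (proj₂ (Hf s)))) ,
         ¬joins {f s}
  φ-inj : ∀ s s′ → newBlock (f s) ≋ newBlock (f s′) → s ≡ s′
  φ-inj s s′ φ≋ = f-inj s s′ λ a b → φ≋ (suc a) (suc b)
  φ-onto : ∀ R → HasBlocks (suc k) R × ¬ JoinsLater R → Σ (Fin n) λ s → R ≋ newBlock (f s)
  φ-onto R ((E , e) , ¬J) =
    let s , R≋fs = f-onto (R on suc)
                          (isEquivalenceᵇ-on suc E ,
                           suc-injective (≡.trans (≡.sym (blockCount-¬joinsLater ¬J)) e))
    in s , λ x y → ≡.trans (¬joinsLater-η E ¬J x y) (extend-cong (λ _ → ≡.refl) R≋fs x y)

size-hasBlocks : ∀ m k → HasSize (HasBlocks {m} k) (stirling₂ m k)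
size-hasBlocks zero    zero    =
  (λ _ ()) , (λ _ → ((λ ()) , (λ ()) , λ ()) , ≡.refl) ,
  (λ { zero zero _ → ≡.refl }) , λ _ _ → zero , λ ()
size-hasBlocks zero    (suc k) = size-zero λ { _ (_ , ()) }
size-hasBlocks (suc m) zero    =
  size-zero λ R (E , e) → no-blocks (proj₁ (proj₂ (blockMaxima-cover E zero))) e
  where
  no-blocks : ∀ {r} {xs : List (Fin (suc m))} → r ∈ xs → length xs ≢ 0
  no-blocks (here _)  ()
  no-blocks (there _) ()
size-hasBlocks (suc m) (suc k) =
  enumeration-⇔ [ proj₁ , proj₁ ]′ (λ {R} H → Sum.map (H ,_) (H ,_) (toSum (joinsLater? R)))
    (size-+ (size-joinsLater (size-hasBlocks m (suc k))) (size-¬joinsLater (size-hasBlocks m k))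
            λ { (_ , b , R0b) (_ , ¬J) R≋S → ¬J (b , ≡.trans (≡.sym (R≋S zero (suc b))) R0b) })

size-equivalences-Fin : ∀ m → HasSize {Fin m} IsEquivalenceᵇ (bell m)
size-equivalences-Fin m =
  ≡.subst (HasSize IsEquivalenceᵇ) (cong sum (≡.sym (map-upTo (stirling₂ m) (suc m))))
    (enumeration-⇔ (λ (_ , _ , E , _) → E) (λ {R} E → blockCount R , s≤s (blockCount≤ R) , E , ≡.refl)
      (size-⋃< (suc m) (λ k _ → size-hasBlocks m k)
        λ (_ , e) (_ , e′) R≋S → ≡.trans (≡.sym e) (≡.trans (cong length (blockMaxima-cong R≋S)) e′)))

size-setPartitions-bell : ∀ k → HasSize {Point k} IsSetPartition (bell (2 * k))
size-setPartitions-bell k =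
  ≡.subst (λ n → HasSize (IsSetPartition {k}) (bell n)) (cong (k +_) (≡.sym (+-identityʳ k)))
    (size-equivalences-↔ (+↔⊎ {k} {k}) (size-equivalences-Fin (k + k)))

column : ∀ {k} → Point k → ℕ
column (inj₁ i) = toℕ i
column (inj₂ i) = toℕ i

column<k : ∀ {k} (x : Point k) → column x < k
column<k (inj₁ i) = toℕ<n i
column<k (inj₂ i) = toℕ<n i

SplitsAt : ∀ {k} → ℕ → Rel k → Set
SplitsAt j π = ∀ x y → column x < j → j ≤ column y → π x y ≡ false

splitsAt-order : ∀ {k} (π : Rel k) → SplitsAt k π
splitsAt-order π x y _ k≤y = contradiction (column<k y) (≤⇒≯ k≤y)

inject : ∀ {p m} → Point p ⊎ Point m → Point (p + m)
inject {p} {m} (inj₁ a) = Sum.map (_↑ˡ m) (_↑ˡ m) a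
inject {p} {m} (inj₂ b) = Sum.map (p ↑ʳ_) (p ↑ʳ_) b

splitPt-inject : ∀ {p m} (u : Point p ⊎ Point m) → splitPt p (inject u) ≡ u
splitPt-inject {p} {m} (inj₁ (inj₁ i)) rewrite splitAt-↑ˡ p i m = ≡.refl
splitPt-inject {p} {m} (inj₁ (inj₂ i)) rewrite splitAt-↑ˡ p i m = ≡.refl
splitPt-inject {p} {m} (inj₂ (inj₁ i)) rewrite splitAt-↑ʳ p m i = ≡.refl
splitPt-inject {p} {m} (inj₂ (inj₂ i)) rewrite splitAt-↑ʳ p m i = ≡.refl

inject-splitPt : ∀ p {m} (x : Point (p + m)) → inject (splitPt p x) ≡ x
inject-splitPt p (inj₁ i) with splitAt p i in e
... | inj₁ j = cong inj₁ (splitAt⁻¹-↑ˡ e)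
... | inj₂ j = cong inj₁ (splitAt⁻¹-↑ʳ e)
inject-splitPt p (inj₂ i) with splitAt p i in e
... | inj₁ j = cong inj₂ (splitAt⁻¹-↑ˡ e)
... | inj₂ j = cong inj₂ (splitAt⁻¹-↑ʳ e)

data Side (p m : ℕ) : Point (p + m) → Set where
  left  : (a : Point p) → Side p m (inject (inj₁ a))
  right : (b : Point m) → Side p m (inject (inj₂ b))

side : ∀ p {m} (x : Point (p + m)) → Side p m x
side p x with splitPt p x | inject-splitPt p x
... | inj₁ a | ≡.refl = left a
... | inj₂ b | ≡.refl = right b

column-left : ∀ {p m} (a : Point p) → column (inject {p} {m} (inj₁ a)) ≡ column a
column-left {m = m} (inj₁ i) = toℕ-↑ˡ i m
column-left {m = m} (inj₂ i) = toℕ-↑ˡ i m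

column-right : ∀ {p m} (b : Point m) → column (inject {p} {m} (inj₂ b)) ≡ p + column b
column-right {p} (inj₁ i) = toℕ-↑ʳ p i
column-right {p} (inj₂ i) = toℕ-↑ʳ p i

left<p : ∀ {p m} (a : Point p) → column (inject {p} {m} (inj₁ a)) < p
left<p a = ≡.subst (_< _) (≡.sym (column-left a)) (column<k a)

p≤right : ∀ {p m} (b : Point m) → p ≤ column (inject {p} {m} (inj₂ b))
p≤right {p} b = ≡.subst (p ≤_) (≡.sym (column-right b)) (m≤m+n p _)

_⊎ᵇ_ : ∀ {X Y : Set} → (X → X → Bool) → (Y → Y → Bool) → X ⊎ Y → X ⊎ Y → Bool
(R ⊎ᵇ S) (inj₁ a) (inj₁ a′) = R a a′
(R ⊎ᵇ S) (inj₂ b) (inj₂ b′) = S b b′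
(R ⊎ᵇ S) (inj₁ _) (inj₂ _)  = false
(R ⊎ᵇ S) (inj₂ _) (inj₁ _)  = false

isEquivalenceᵇ-⊎ᵇ : ∀ {X Y : Set} {R : X → X → Bool} {S : Y → Y → Bool} →
                    IsEquivalenceᵇ R → IsEquivalenceᵇ S → IsEquivalenceᵇ (R ⊎ᵇ S)
isEquivalenceᵇ-⊎ᵇ {R = R} {S} (reflR , symR , transR) (reflS , symS , transS) =
  refl′ , sym′ , trans′
  where
  refl′ : ∀ u → (R ⊎ᵇ S) u u ≡ true
  refl′ (inj₁ a) = reflR a
  refl′ (inj₂ b) = reflS b
  sym′ : ∀ u v → (R ⊎ᵇ S) u v ≡ true → (R ⊎ᵇ S) v u ≡ true
  sym′ (inj₁ a) (inj₁ a′) = symR a a′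
  sym′ (inj₂ b) (inj₂ b′) = symS b b′
  trans′ : ∀ u v w →
           (R ⊎ᵇ S) u v ≡ true → (R ⊎ᵇ S) v w ≡ true → (R ⊎ᵇ S) u w ≡ true
  trans′ (inj₁ a) (inj₁ a′) (inj₁ a″) = transR a a′ a″
  trans′ (inj₂ b) (inj₂ b′) (inj₂ b″) = transS b b′ b″

⊗-splitPt : ∀ {p m} (ρ : Rel p) (σ : Rel m) → (ρ ⊗ σ) ≋ ((ρ ⊎ᵇ σ) on splitPt p)
⊗-splitPt {p} ρ σ x y with splitPt p x | splitPt p y
... | inj₁ _ | inj₁ _ = ≡.refl
... | inj₁ _ | inj₂ _ = ≡.refl
... | inj₂ _ | inj₁ _ = ≡.refl
... | inj₂ _ | inj₂ _ = ≡.refl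

⊗-inject : ∀ {p m} (ρ : Rel p) (σ : Rel m) u v → (ρ ⊗ σ) (inject u) (inject v) ≡ (ρ ⊎ᵇ σ) u v
⊗-inject ρ σ u v =
  ≡.trans (⊗-splitPt ρ σ (inject u) (inject v)) (≡.cong₂ (ρ ⊎ᵇ σ) (splitPt-inject u) (splitPt-inject v))

⊗-isSetPartition : ∀ {p m} {ρ : Rel p} {σ : Rel m} →
                   IsSetPartition ρ → IsSetPartition σ → IsSetPartition (ρ ⊗ σ)
⊗-isSetPartition {p} {ρ = ρ} {σ} Eρ Eσ =
  isEquivalenceᵇ-resp (λ x y → ≡.sym (⊗-splitPt ρ σ x y))
                      (isEquivalenceᵇ-on (splitPt p) (isEquivalenceᵇ-⊎ᵇ Eρ Eσ))

⊗-cong : ∀ {p m} {ρ ρ′ : Rel p} {σ σ′ : Rel m} → ρ ≋ ρ′ → σ ≋ σ′ → (ρ ⊗ σ) ≋ (ρ′ ⊗ σ′)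
⊗-cong {p} {ρ = ρ} {ρ′} {σ} {σ′} ρ≋ρ′ σ≋σ′ x y = begin
  (ρ ⊗ σ) x y                                 ≡⟨ ⊗-splitPt ρ σ x y ⟩
  (ρ ⊎ᵇ σ) (splitPt p x) (splitPt p y)         ≡⟨ ⊎ᵇ-cong (splitPt p x) (splitPt p y) ⟩
  (ρ′ ⊎ᵇ σ′) (splitPt p x) (splitPt p y)       ≡⟨ ⊗-splitPt ρ′ σ′ x y ⟨
  (ρ′ ⊗ σ′) x y                               ∎
  where
  open ≡.≡-Reasoning
  ⊎ᵇ-cong : ∀ u v → (ρ ⊎ᵇ σ) u v ≡ (ρ′ ⊎ᵇ σ′) u v
  ⊎ᵇ-cong (inj₁ a) (inj₁ a′) = ρ≋ρ′ a a′
  ⊎ᵇ-cong (inj₂ b) (inj₂ b′) = σ≋σ′ b b′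
  ⊎ᵇ-cong (inj₁ _) (inj₂ _)  = ≡.refl
  ⊎ᵇ-cong (inj₂ _) (inj₁ _)  = ≡.refl

leftPart : ∀ {p m} → Rel (p + m) → Rel p
leftPart π = π on (inject ∘ inj₁)

rightPart : ∀ {p m} → Rel (p + m) → Rel m
rightPart π = π on (inject ∘ inj₂)

splitsAt-⊗ : ∀ {p m} (ρ : Rel p) (σ : Rel m) → SplitsAt p (ρ ⊗ σ)
splitsAt-⊗ {p} {m} ρ σ x y x<p p≤y with side p x | side p y
... | left a  | right b = ⊗-inject ρ σ (inj₁ a) (inj₂ b)
... | right a | _       = contradiction x<p (≤⇒≯ (p≤right {p} a))
... | left _  | left b  = contradiction (left<p {m = m} b) (≤⇒≯ p≤y)

splitsAt-⊗⇒splitsAt-left : ∀ {p m j} {ρ : Rel p} {σ : Rel m} → SplitsAt j (ρ ⊗ σ) → SplitsAt j ρ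
splitsAt-⊗⇒splitsAt-left {p} {m} {j} {ρ} {σ} split a b a<j j≤b =
  ≡.trans (≡.sym (⊗-inject ρ σ (inj₁ a) (inj₁ b)))
          (split (inject {p} {m} (inj₁ a)) (inject (inj₁ b))
                 (≡.subst (_< j) (≡.sym (column-left {m = m} a)) a<j)
                 (≡.subst (j ≤_) (≡.sym (column-left {m = m} b)) j≤b))

splitsAt-left⇒splitsAt : ∀ {p m j} {π : Rel (p + m)} → j < p → SplitsAt p π →
                         SplitsAt j (leftPart {p} {m} π) → SplitsAt j π
splitsAt-left⇒splitsAt {p} {m} {j} j<p split splitL x y x<j j≤y with side p y
... | right b = split x _ (<-trans x<j j<p) (p≤right {p} b)
... | left b with side p x
...   | right a = contradiction (<-trans x<j j<p) (≤⇒≯ (p≤right {p} a))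
...   | left a  = splitL a b (≡.subst (_< j) (column-left {m = m} a) x<j)
                             (≡.subst (j ≤_) (column-left {m = m} b) j≤y)

splitsAt⇒≋⊗ : ∀ {p m} {π : Rel (p + m)} → IsSetPartition π → SplitsAt p π →
              π ≋ (leftPart {p} {m} π ⊗ rightPart {p} {m} π)
splitsAt⇒≋⊗ {p} {m} {π} (_ , sym , _) split x y = by-sides (side p x) (side p y)
  where
  ρ : Rel p
  ρ = leftPart {p} {m} π
  σ : Rel m
  σ = rightPart {p} {m} π
  true≢false : true ≢ false
  true≢false ()
  by-sides : ∀ {x y} → Side p m x → Side p m y → π x y ≡ (ρ ⊗ σ) x y
  by-sides (left a)  (left b)  = ≡.sym (⊗-inject ρ σ (inj₁ a) (inj₁ b))
  by-sides (right a) (right b) = ≡.sym (⊗-inject ρ σ (inj₂ a) (inj₂ b))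
  by-sides (left a)  (right b) =
    ≡.trans (split _ _ (left<p {m = m} a) (p≤right {p} b)) (≡.sym (⊗-inject ρ σ (inj₁ a) (inj₂ b)))
  by-sides (right a) (left b)  =
    ≡.trans (¬-not λ πab → true≢false (≡.trans (≡.sym (sym _ _ πab)) π-ba)) (≡.sym (⊗-inject ρ σ (inj₂ a) (inj₁ b)))
    where
    π-ba : π (inject (inj₁ b)) (inject (inj₂ a)) ≡ false
    π-ba = split _ _ (left<p {m = m} b) (p≤right {p} a)

splitsAt⇒reducible : ∀ {k j} {π : Rel k} → IsSetPartition π → 1 ≤ j → j < k → SplitsAt j π → Reducible π
splitsAt⇒reducible {j = j} E 1≤j j<k = split-into (m+[n∸m]≡n (<⇒≤ j<k)) (m<n⇒0<n∸m j<k) E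
  where
  split-into : ∀ {m k} {π : Rel k} → j + m ≡ k → 1 ≤ m → IsSetPartition π → SplitsAt j π → Reducible π
  split-into {m} {π = π} ≡.refl 1≤m E split =
    j , m , 1≤j , 1≤m , ≡.refl , leftPart {j} {m} π , rightPart {j} {m} π ,
    isEquivalenceᵇ-on _ E , isEquivalenceᵇ-on _ E , splitsAt⇒≋⊗ E split

reducible⇒splitsAt : ∀ {k} {π : Rel k} → Reducible π → ∃[ j ] 1 ≤ j × j < k × SplitsAt j π
reducible⇒splitsAt (k₁ , k₂ , 1≤k₁ , 1≤k₂ , ≡.refl , ρ₁ , ρ₂ , _ , _ , π≋) =
  k₁ , 1≤k₁ , m<m+n k₁ 1≤k₂ , λ x y x< ≤y → ≡.trans (π≋ x y) (splitsAt-⊗ ρ₁ ρ₂ x y x< ≤y)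

reducible-resp : ∀ {k} {π π′ : Rel k} → π ≋ π′ → Reducible π′ → Reducible π
reducible-resp π≋π′ (k₁ , k₂ , 1≤k₁ , 1≤k₂ , e , ρ₁ , ρ₂ , E₁ , E₂ , π′≋) =
  k₁ , k₂ , 1≤k₁ , 1≤k₂ , e , ρ₁ , ρ₂ , E₁ , E₂ , λ x y → ≡.trans (π≋π′ x y) (π′≋ x y)

irredDiagram-resp : ∀ {k} {π π′ : Rel k} → π ≋ π′ → IrredDiagram k π → IrredDiagram k π′
irredDiagram-resp π≋π′ (1≤k , E , irr) = 1≤k , isEquivalenceᵇ-resp π≋π′ E , irr ∘ reducible-resp π≋π′

all-Point? : ∀ {k p} {P : Point k → Set p} → Decidable P → Dec (∀ x → P x)
all-Point? P? =
  map′ (λ (f , g) → Sum.[ f , g ]) (λ h → h ∘ inj₁ , h ∘ inj₂) (all? (P? ∘ inj₁) ×-dec all? (P? ∘ inj₂))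

isSetPartition? : ∀ {k} → Decidable (IsSetPartition {k})
isSetPartition? π =
  all-Point? (λ x → π x x Bool.≟ true) ×-dec
  all-Point? (λ x → all-Point? λ y → (π x y Bool.≟ true) →-dec (π y x Bool.≟ true)) ×-dec
  all-Point? (λ x → all-Point? λ y → all-Point? λ z →
    (π x y Bool.≟ true) →-dec ((π y z Bool.≟ true) →-dec (π x z Bool.≟ true)))

splitsAt? : ∀ {k} j → Decidable (SplitsAt {k} j)
splitsAt? j π = all-Point? λ x → all-Point? λ y →
  (column x <? j) →-dec ((j ≤? column y) →-dec (π x y Bool.≟ false))

irredDiagram? : ∀ k → Decidable (IrredDiagram k)
irredDiagram? k π with 1 ≤? k | isSetPartition? π
... | no 1≰k  | _     = no (1≰k ∘ proj₁)
... | yes _   | no ¬E = no (¬E ∘ proj₁ ∘ proj₂)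
... | yes 1≤k | yes E = map′ (λ irr → 1≤k , E , irr) (proj₂ ∘ proj₂) (¬? reducible?)
  where
  reducible? : Dec (Reducible π)
  reducible? = map′ (λ (j , j<k , 1≤j , split) → splitsAt⇒reducible E 1≤j j<k split)
                    (λ r → let j , 1≤j , j<k , split = reducible⇒splitsAt r in j , j<k , 1≤j , split)
                    (anyUpTo? (λ j → (1 ≤? j) ×-dec splitsAt? j π) k)

irreducibleCount : ∀ k → ∃[ n ] IrredCount k n
irreducibleCount k =
  size-filter (size-setPartitions-bell k) (irredDiagram? k) irredDiagram-resp (proj₁ ∘ proj₂)

LeastSplit : ∀ {k} → ℕ → Rel k → Set
LeastSplit p π = SplitsAt p π × (∀ {j} → 1 ≤ j → j < p → ¬ SplitsAt j π)

splitsAt-resp : ∀ {k j} {π π′ : Rel k} → π ≋ π′ → SplitsAt j π → SplitsAt j π′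
splitsAt-resp π≋π′ split x y x<j j≤y = ≡.trans (≡.sym (π≋π′ x y)) (split x y x<j j≤y)

least-witness : ∀ {p} {P : ℕ → Set p} → Decidable P →
                ∀ {n} → P n → ∃[ j ] P j × (∀ {i} → i < j → ¬ P i)
least-witness {P = P} P? {n} = <-rec Least search n
  where
  Least : ℕ → Set _
  Least n = P n → ∃[ j ] P j × (∀ {i} → i < j → ¬ P i)
  search : ∀ n → (∀ {i} → i < n → Least i) → Least n
  search n below Pn with anyUpTo? P? n
  ... | yes (i , i<n , Pi) = below i<n Pi
  ... | no ∄i              = n , Pn , λ i<n Pi → ∄i (_ , i<n , Pi)

leastSplit : ∀ {n} (π : Rel (suc n)) → ∃[ j ] j < suc n × LeastSplit (suc j) π
leastSplit {n} π with least-witness (λ j → splitsAt? (suc j) π) (splitsAt-order π)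
... | j , split , below = j , s≤s (≮⇒≥ λ n<j → below n<j (splitsAt-order π)) , split , least
  where
  least : ∀ {i} → 1 ≤ i → i < suc j → ¬ SplitsAt i π
  least {suc _} _ (s≤s i<j) = below i<j

leastSplit-unique : ∀ {k p q} {π π′ : Rel k} → LeastSplit p π → LeastSplit q π′ → π ≋ π′ →
                    1 ≤ p → 1 ≤ q → p ≡ q
leastSplit-unique {p = p} {q} (split , least) (split′ , least′) π≋π′ 1≤p 1≤q with <-cmp p q
... | tri< p<q _ _ = contradiction (splitsAt-resp π≋π′ split) (least′ 1≤p p<q)
... | tri≈ _ p≡q _ = p≡q
... | tri> _ _ q<p = contradiction (splitsAt-resp (λ x y → ≡.sym (π≋π′ x y)) split′) (least 1≤q q<p)

leftPart-irredDiagram : ∀ {p m} {π : Rel (p + m)} → 1 ≤ p → IsSetPartition π → LeastSplit p π →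
                        IrredDiagram p (leftPart {p} {m} π)
leftPart-irredDiagram 1≤p E (split , least) =
  1≤p , isEquivalenceᵇ-on _ E ,
  λ r → let j , 1≤j , j<p , splitL = reducible⇒splitsAt r in
        least 1≤j j<p (splitsAt-left⇒splitsAt j<p split splitL)

size-leastSplit : ∀ {p m c d} → 1 ≤ p → IrredCount p c → HasSize {Point m} IsSetPartition d →
                  HasSize {Point (p + m)} (λ π → IsSetPartition π × LeastSplit p π) (c * d)
size-leastSplit {p} {m} {c} {d} 1≤p (f , Hf , f-inj , f-onto) (g , Eg , g-inj , g-onto) =
  size-* (φ , Hφ , φ-inj , φ-onto)
  where
  φ : Fin c × Fin d → Rel (p + m)
  φ (s , t) = f s ⊗ g t
  Hφ : ∀ i → IsSetPartition (φ i) × LeastSplit p (φ i)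
  Hφ (s , t) = let _ , Ef , irr = Hf s in
    ⊗-isSetPartition Ef (Eg t) , splitsAt-⊗ (f s) (g t) ,
    λ 1≤j j<p split → irr (splitsAt⇒reducible Ef 1≤j j<p (splitsAt-⊗⇒splitsAt-left split))
  φ-inj : ∀ i i′ → φ i ≋ φ i′ → i ≡ i′
  φ-inj (s , t) (s′ , t′) φ≋ =
    ≡.cong₂ _,_ (f-inj s s′ λ a b → parts (inj₁ a) (inj₁ b)) (g-inj t t′ λ a b → parts (inj₂ a) (inj₂ b))
    where
    parts : ∀ u v → (f s ⊎ᵇ g t) u v ≡ (f s′ ⊎ᵇ g t′) u v
    parts u v = ≡.trans (≡.sym (⊗-inject (f s) (g t) u v))
                        (≡.trans (φ≋ (inject u) (inject v)) (⊗-inject (f s′) (g t′) u v))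
  φ-onto : ∀ π → IsSetPartition π × LeastSplit p π → Σ (Fin c × Fin d) λ i → π ≋ φ i
  φ-onto π (E , least) =
    let s , left≋ = f-onto (leftPart {p} {m} π) (leftPart-irredDiagram 1≤p E least)
        t , right≋ = g-onto (rightPart {p} {m} π) (isEquivalenceᵇ-on _ E)
    in (s , t) , λ x y → ≡.trans (splitsAt⇒≋⊗ E (proj₁ least) x y) (⊗-cong left≋ right≋ x y)

-- The sum over all compositions of n, (n) included; it is only meaningful when n ≤ fuel.
compositionSum : (ℕ → ℕ) → ℕ → ℕ → ℕ
compositionSum a fuel n = sum (map (product ∘ map a) (compositionsF fuel n))

sum-concatMap : ∀ {A : Set} (g : A → List ℕ) xs → sum (concatMap g xs) ≡ sum (map (sum ∘ g) xs)
sum-concatMap g []       = ≡.refl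
sum-concatMap g (x ∷ xs) =
  ≡.trans (sum-++ (g x) (concatMap g xs)) (cong (sum (g x) +_) (sum-concatMap g xs))

sum-map-*ˡ : ∀ {A : Set} c (h : A → ℕ) xs → sum (map (λ x → c * h x) xs) ≡ c * sum (map h xs)
sum-map-*ˡ c h []       = ≡.sym (*-zeroʳ c)
sum-map-*ˡ c h (x ∷ xs) =
  ≡.trans (cong (c * h x +_) (sum-map-*ˡ c h xs)) (≡.sym (*-distribˡ-+ c (h x) _))

compositionSum-suc : ∀ a fuel n → compositionSum a (suc fuel) (suc n) ≡
                     sum (applyUpTo (λ j → a (suc j) * compositionSum a fuel (n ∸ j)) (suc n))
compositionSum-suc a fuel n = begin
  sum (map w (concatMap g (upTo (suc n))))      ≡⟨ cong sum (map-concatMap w g (upTo (suc n))) ⟩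
  sum (concatMap (map w ∘ g) (upTo (suc n)))    ≡⟨ sum-concatMap (map w ∘ g) (upTo (suc n)) ⟩
  sum (map (sum ∘ map w ∘ g) (upTo (suc n)))    ≡⟨ cong sum (map-cong first-part (upTo (suc n))) ⟩
  sum (map h (upTo (suc n)))                    ≡⟨ cong sum (map-upTo h (suc n)) ⟩
  sum (applyUpTo h (suc n))                     ∎
  where
  open ≡.≡-Reasoning
  w : List ℕ → ℕ
  w = product ∘ map a
  g : ℕ → List (List ℕ)
  g j = map (suc j ∷_) (compositionsF fuel (n ∸ j))
  h : ℕ → ℕ
  h j = a (suc j) * compositionSum a fuel (n ∸ j)
  first-part : ∀ j → sum (map w (g j)) ≡ h j
  first-part j = ≡.trans (cong sum (≡.sym (map-∘ (compositionsF fuel (n ∸ j)))))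
                         (sum-map-*ˡ (a (suc j)) w (compositionsF fuel (n ∸ j)))

module _ (n : ℕ) where

  private
    startingWith : ℕ → List (List ℕ)
    startingWith j = map (suc j ∷_) (compositionsF n (n ∸ j))

    proper : List (List ℕ)
    proper = concatMap startingWith (upTo n)

  compositions-suc : compositions (suc n) ≡ proper ++ [ [ suc n ] ]
  compositions-suc = begin
    concatMap startingWith (upTo (suc n))  ≡⟨ cong (concatMap startingWith) (≡.sym (upTo-∷ʳ n)) ⟩
    concatMap startingWith (upTo n ∷ʳ n)   ≡⟨ concatMap-++ startingWith (upTo n) [ n ] ⟩
    proper ++ startingWith n ++ []         ≡⟨ cong (λ r → proper ++ map (suc n ∷_) (compositionsF n r) ++ [])
                                                   (n∸n≡0 n) ⟩
    proper ++ [ [ suc n ] ]                ∎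
    where open ≡.≡-Reasoning

  proper-≢ : All (_≢ [ suc n ]) proper
  proper-≢ = All.tabulate λ α∈ → first-part< (find (∈-concatMap⁻ startingWith {xs = upTo n} α∈))
    where
    first-part< : ∀ {α} → ∃[ j ] j ∈ upTo n × α ∈ startingWith j → α ≢ [ suc n ]
    first-part< (j , j∈ , α∈) with ∈-map⁻ (suc j ∷_) α∈
    ... | _ , _ , ≡.refl = λ α≡ → <-irrefl (suc-injective (∷-injectiveˡ α≡)) (∈-upTo⁻ j∈)

  compositionSum-diag : ∀ a → compositionSum a (suc n) (suc n) ≡ a (suc n) + compSum a (suc n)
  compositionSum-diag a = begin
    sum (map w (compositions k))            ≡⟨ cong (sum ∘ map w) compositions-suc ⟩
    sum (map w (proper ++ [ [ k ] ]))       ≡⟨ cong sum (map-++ w proper [ [ k ] ]) ⟩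
    sum (map w proper ++ [ a k * 1 ])       ≡⟨ sum-++ (map w proper) [ a k * 1 ] ⟩
    sum (map w proper) + (a k * 1 + 0)      ≡⟨ +-comm (sum (map w proper)) _ ⟩
    a k * 1 + 0 + sum (map w proper)        ≡⟨ cong (_+ sum (map w proper)) a[k]≡ ⟩
    a k + sum (map w proper)                ≡⟨ cong (λ αs → a k + sum (map w αs)) proper-filtered ⟨
    a k + compSum a k                       ∎
    where
    open ≡.≡-Reasoning
    k : ℕ
    k = suc n
    w : List ℕ → ℕ
    w = product ∘ map a
    a[k]≡ : a k * 1 + 0 ≡ a k
    a[k]≡ = ≡.trans (+-identityʳ _) (*-identityʳ (a k))
    ≢[k]? : Decidable (_≢ [ k ])
    ≢[k]? α = ¬? (≡-dec _≟_ α [ k ])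
    proper-filtered : filter ≢[k]? (compositions k) ≡ proper
    proper-filtered = begin
      filter ≢[k]? (compositions k)                  ≡⟨ cong (filter ≢[k]?) compositions-suc ⟩
      filter ≢[k]? (proper ++ [ [ k ] ])             ≡⟨ filter-++ ≢[k]? proper [ [ k ] ] ⟩
      filter ≢[k]? proper ++ filter ≢[k]? [ [ k ] ]  ≡⟨ ≡.cong₂ _++_ (filter-all ≢[k]? proper-≢)
                                                                 (filter-none ≢[k]? ((λ ≢ → ≢ ≡.refl) ∷ [])) ⟩
      proper ++ []                                  ≡⟨ ++-identityʳ proper ⟩
      proper                                        ∎

size-setPartitions : (a : ℕ → ℕ) → (∀ k → 1 ≤ k → IrredCount k (a k)) →
                     ∀ fuel n → n ≤ fuel → HasSize {Point n} IsSetPartition (compositionSum a fuel n)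
size-setPartitions a irr _          zero    _         = size-setPartitions-bell 0
size-setPartitions a irr (suc fuel) (suc n) (s≤s n≤f) =
  ≡.subst (HasSize IsSetPartition) (≡.sym (compositionSum-suc a fuel n))
    (enumeration-⇔ (λ (_ , _ , E , _) → E)
                   (λ {π} E → let j , j<1+n , least = leastSplit π in j , j<1+n , E , least)
      (size-⋃< (suc n) by-leastSplit λ (_ , least) (_ , least′) π≋π′ →
        suc-injective (leastSplit-unique least least′ π≋π′ (s≤s z≤n) (s≤s z≤n))))
  where
  count : ℕ → ℕ
  count j = a (suc j) * compositionSum a fuel (n ∸ j)
  by-leastSplit : ∀ j → j < suc n → HasSize (λ π → IsSetPartition π × LeastSplit (suc j) π) (count j)
  by-leastSplit j (s≤s j≤n) =
    ≡.subst (λ k → HasSize {Point k} (λ π → IsSetPartition π × LeastSplit (suc j) π) (count j))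
            (cong suc (m+[n∸m]≡n j≤n))
            (size-leastSplit (s≤s z≤n) (irr (suc j) (s≤s z≤n))
                             (size-setPartitions a irr fuel (n ∸ j) (≤-trans (m∸n≤m n j) n≤f)))

irreducibleCount-recurrence : (a : ℕ → ℕ) → (∀ k → 1 ≤ k → IrredCount k (a k)) →
                              ∀ k → 1 ≤ k → a k + compSum a k ≡ bell (2 * k)
irreducibleCount-recurrence a irr (suc n) _ = begin
  a (suc n) + compSum a (suc n)     ≡⟨ compositionSum-diag n a ⟨
  compositionSum a (suc n) (suc n)  ≡⟨ size-unique (size-setPartitions a irr (suc n) (suc n) ≤-refl)
                                                   (size-setPartitions-bell (suc n)) ⟩
  bell (2 * suc n)                  ∎
  where open ≡.≡-Reasoning

theorem2p5 : Σ (ℕ → ℕ) (λ a → ∀ k → 1 ≤ k → IrredCount k (a k))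
    × ((a : ℕ → ℕ) → (∀ k → 1 ≤ k → IrredCount k (a k))
    → (a 1 ≡ 2) × (∀ k → 1 ≤ k → a k + compSum a k ≡ bell (2 * k)))
-- compSum a 1 and bell 2 evaluate to 0 and 2.
theorem2p5 =
  ((λ k → proj₁ (irreducibleCount k)) , λ k _ → proj₂ (irreducibleCount k)) ,
  λ a irr → ≡.trans (≡.sym (+-identityʳ (a 1))) (irreducibleCount-recurrence a irr 1 (s≤s z≤n)) ,
            irreducibleCount-recurrence a irr
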